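{- $\mathsf{N} = \mathsf{MS4} + \Box \exists p \to \Diamond\exists \Box p = \mathsf{MS4} + \blacksquare \Diamond p \to \Diamond \forall p$.
   Context: $\mathsf{MS4}$ is the bimodal logic in the language with modalities $\Box$ and $\forall$ (with $\Diamond=\neg\Box\neg$, $\exists=\neg\forall\neg$) containing classical propositional logic, the $\mathsf{S4}$-axioms for $\Box$, the $\mathsf{S5}$-axioms for $\forall$, the left commutativity axiom $\Box\forall p\to\forall\Box p$, and closed under modus ponens, substitution and both necessitation rules. $\blacksquare$ denotes the compound modality $\Box\forall$, and $\mathsf{MS4}\vdash \neg\blacksquare\neg p\leftrightarrow \Diamond\exists p$. The Naumov logic is $\mathsf{N}=\mathsf{MS4}+\Box\exists p\to\Diamond\exists\Box p$. -}

module Defs where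

open import Data.Nat using (ℕ)
open import Data.Product using (_×_)

-- Bimodal formulas: variables, falsum, implication, □ and the universal modality ∀ (written 𝔸).
infixr 5 _⇒_
data Fm : Set where
  var : ℕ → Fm
  ⊥ₘ  : Fm
  _⇒_ : Fm → Fm → Fm
  □   : Fm → Fm
  𝔸   : Fm → Fm

¬ₘ : Fm → Fm
¬ₘ φ = φ ⇒ ⊥ₘ

◇ : Fm → Fm
◇ φ = ¬ₘ (□ (¬ₘ φ))

𝔼 : Fm → Fm
𝔼 φ = ¬ₘ (𝔸 (¬ₘ φ))

■ : Fm → Fm
■ φ = □ (𝔸 φ)

p q r : Fm
p = var 0
q = var 1
r = var 2

Subst : Set
Subst = ℕ → Fm

sub : Subst → Fm → Fm
sub σ (var n) = σ n
sub σ ⊥ₘ      = ⊥ₘ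
sub σ (φ ⇒ ψ) = sub σ φ ⇒ sub σ ψ
sub σ (□ φ)   = □ (sub σ φ)
sub σ (𝔸 φ)   = 𝔸 (sub σ φ)

-- MS4 + χ : the least set of formulas containing classical propositional logic
-- (complete Hilbert axiomatisation for {⇒,⊥}), the S4 axioms for □, the S5
-- axioms for ∀, left commutativity □∀p → ∀□p, and the extra axiom χ, closed
-- under modus ponens, substitution and both necessitation rules.
data _⊢_ (χ : Fm) : Fm → Set where
  ax1  : χ ⊢ (p ⇒ q ⇒ p)
  ax2  : χ ⊢ ((p ⇒ q ⇒ r) ⇒ (p ⇒ q) ⇒ p ⇒ r)
  ax3  : χ ⊢ (¬ₘ (¬ₘ p) ⇒ p)
  K□   : χ ⊢ (□ (p ⇒ q) ⇒ □ p ⇒ □ q)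
  T□   : χ ⊢ (□ p ⇒ p)
  4□   : χ ⊢ (□ p ⇒ □ (□ p))
  K𝔸   : χ ⊢ (𝔸 (p ⇒ q) ⇒ 𝔸 p ⇒ 𝔸 q)
  T𝔸   : χ ⊢ (𝔸 p ⇒ p)
  5𝔸   : χ ⊢ (𝔼 p ⇒ 𝔸 (𝔼 p))
  lcom : χ ⊢ (□ (𝔸 p) ⇒ 𝔸 (□ p))
  extra : χ ⊢ χ
  mp   : ∀ {φ ψ} → χ ⊢ (φ ⇒ ψ) → χ ⊢ φ → χ ⊢ ψ
  subst : ∀ {φ} (σ : Subst) → χ ⊢ φ → χ ⊢ sub σ φ
  nec□ : ∀ {φ} → χ ⊢ φ → χ ⊢ □ φ
  nec𝔸 : ∀ {φ} → χ ⊢ φ → χ ⊢ 𝔸 φ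

naumovAx : Fm
naumovAx = □ (𝔼 p) ⇒ ◇ (𝔼 (□ p))

altAx : Fm
altAx = ■ (◇ p) ⇒ ◇ (𝔸 p)

SameLogic : Fm → Fm → Set
SameLogic χ₁ χ₂ = ∀ φ → (χ₁ ⊢ φ → χ₂ ⊢ φ) × (χ₂ ⊢ φ → χ₁ ⊢ φ)

module Submission where

open import Defs
open import Data.Nat using (zero; suc)
open import Data.Product using (_,_)

-- Each axiom is, up to the dualities ◇ = ¬□¬ and ∃ = ¬∀¬ and double negation,
-- the contrapositive of the other one instantiated at ¬p: from ■◇¬p → ◇∀¬p one
-- gets ¬◇∀¬p → ¬■◇¬p, i.e. □∃p → ◇∃□p, and symmetrically.

sub₃ : Fm → Fm → Fm → Subst
sub₃ a b c zero          = a
sub₃ a b c (suc zero)    = b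
sub₃ a b c (suc (suc n)) = c

module _ {χ : Fm} where

  ⊢K : ∀ a b → χ ⊢ (a ⇒ b ⇒ a)
  ⊢K a b = subst (sub₃ a b ⊥ₘ) ax1

  ⊢S : ∀ a b c → χ ⊢ ((a ⇒ b ⇒ c) ⇒ (a ⇒ b) ⇒ a ⇒ c)
  ⊢S a b c = subst (sub₃ a b c) ax2

  ⊢¬¬-elim : ∀ a → χ ⊢ (¬ₘ (¬ₘ a) ⇒ a)
  ⊢¬¬-elim a = subst (sub₃ a ⊥ₘ ⊥ₘ) ax3

  ⇒-trans : ∀ {a b c} → χ ⊢ (a ⇒ b) → χ ⊢ (b ⇒ c) → χ ⊢ (a ⇒ c)
  ⇒-trans {a} {b} {c} f g = mp (mp (⊢S a b c) (mp (⊢K (b ⇒ c) a) g)) f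

  ⇒-refl : ∀ a → χ ⊢ (a ⇒ a)
  ⇒-refl a = mp (mp (⊢S a (a ⇒ a) a) (⊢K a (a ⇒ a))) (⊢K a a)

  ⇒-flip : ∀ {a b c} → χ ⊢ (a ⇒ b ⇒ c) → χ ⊢ (b ⇒ a ⇒ c)
  ⇒-flip {a} {b} {c} f = ⇒-trans (⊢K b a) (mp (⊢S a b c) f)

  ⊢¬¬-intro : ∀ a → χ ⊢ (a ⇒ ¬ₘ (¬ₘ a))
  ⊢¬¬-intro a = ⇒-flip (⇒-refl (¬ₘ a))

  contraposition : ∀ {a b} → χ ⊢ (a ⇒ b) → χ ⊢ (¬ₘ b ⇒ ¬ₘ a)
  contraposition {a} {b} f = mp (⇒-flip (⇒-trans (⊢K (b ⇒ ⊥ₘ) a) (⊢S a b ⊥ₘ))) f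

  contraposition-via : ∀ {a b a′ b′} → χ ⊢ (a ⇒ b) →
                       χ ⊢ (a′ ⇒ ¬ₘ b) → χ ⊢ (¬ₘ a ⇒ b′) → χ ⊢ (a′ ⇒ b′)
  contraposition-via f into out = ⇒-trans into (⇒-trans (contraposition f) out)

  □-mono : ∀ {a b} → χ ⊢ (a ⇒ b) → χ ⊢ (□ a ⇒ □ b)
  □-mono {a} {b} f = mp (subst (sub₃ a b ⊥ₘ) K□) (nec□ f)

  𝔸-mono : ∀ {a b} → χ ⊢ (a ⇒ b) → χ ⊢ (𝔸 a ⇒ 𝔸 b)
  𝔸-mono {a} {b} f = mp (subst (sub₃ a b ⊥ₘ) K𝔸) (nec𝔸 f)

  ■◇⇒¬◇𝔼□¬ : ∀ a → χ ⊢ (■ (◇ a) ⇒ ¬ₘ (◇ (𝔼 (□ (¬ₘ a)))))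
  ■◇⇒¬◇𝔼□¬ a = ⇒-trans (□-mono (⊢¬¬-intro (𝔸 (◇ a)))) (⊢¬¬-intro _)

  ¬□𝔼¬⇒◇𝔸 : ∀ a → χ ⊢ (¬ₘ (□ (𝔼 (¬ₘ a))) ⇒ ◇ (𝔸 a))
  ¬□𝔼¬⇒◇𝔸 a = contraposition (□-mono (contraposition (𝔸-mono (⊢¬¬-elim a))))

  □𝔼⇒¬◇𝔸¬ : ∀ a → χ ⊢ (□ (𝔼 a) ⇒ ¬ₘ (◇ (𝔸 (¬ₘ a))))
  □𝔼⇒¬◇𝔸¬ a = ⊢¬¬-intro (□ (𝔼 a))

  ¬■◇¬⇒◇𝔼□ : ∀ a → χ ⊢ (¬ₘ (■ (◇ (¬ₘ a))) ⇒ ◇ (𝔼 (□ a)))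
  ¬■◇¬⇒◇𝔼□ a =
    contraposition (□-mono (⇒-trans (⊢¬¬-elim _)
                                    (𝔸-mono (contraposition (□-mono (⊢¬¬-elim a))))))

⊢-replace-axiom : ∀ {χ₁ χ₂ φ} → χ₁ ⊢ χ₂ → χ₂ ⊢ φ → χ₁ ⊢ φ
⊢-replace-axiom h ax1         = ax1
⊢-replace-axiom h ax2         = ax2
⊢-replace-axiom h ax3         = ax3
⊢-replace-axiom h K□          = K□
⊢-replace-axiom h T□          = T□
⊢-replace-axiom h 4□          = 4□
⊢-replace-axiom h K𝔸          = K𝔸
⊢-replace-axiom h T𝔸          = T𝔸
⊢-replace-axiom h 5𝔸          = 5𝔸
⊢-replace-axiom h lcom        = lcom
⊢-replace-axiom h extra       = h
⊢-replace-axiom h (mp d e)    = mp (⊢-replace-axiom h d) (⊢-replace-axiom h e)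
⊢-replace-axiom h (subst σ d) = subst σ (⊢-replace-axiom h d)
⊢-replace-axiom h (nec□ d)    = nec□ (⊢-replace-axiom h d)
⊢-replace-axiom h (nec𝔸 d)    = nec𝔸 (⊢-replace-axiom h d)

interderivable⇒SameLogic : ∀ {χ₁ χ₂} → χ₁ ⊢ χ₂ → χ₂ ⊢ χ₁ → SameLogic χ₁ χ₂
interderivable⇒SameLogic h₁₂ h₂₁ φ = ⊢-replace-axiom h₂₁ , ⊢-replace-axiom h₁₂

extra[¬p] : ∀ {χ} → χ ⊢ sub (sub₃ (¬ₘ p) q r) χ
extra[¬p] = subst (sub₃ (¬ₘ p) q r) extra

naumov⊢alt : naumovAx ⊢ altAx
naumov⊢alt = contraposition-via extra[¬p] (■◇⇒¬◇𝔼□¬ p) (¬□𝔼¬⇒◇𝔸 p)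

alt⊢naumov : altAx ⊢ naumovAx
alt⊢naumov = contraposition-via extra[¬p] (□𝔼⇒¬◇𝔸¬ p) (¬■◇¬⇒◇𝔼□ p)

lemma5p9 : SameLogic naumovAx altAx
lemma5p9 = interderivable⇒SameLogic naumov⊢alt alt⊢naumov
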